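{- Let $G=(V,E)$ be a connected graph, let $d$ be a positive integer, and let $\pi:V\to\mathbb{Z}$ be a pushing embedding. Then $\pi$ has distortion at most $d$ if and only if for every edge $uv\in E$: $|\mathrm{segment}(\pi(u))-\mathrm{segment}(\pi(v))|\le 1$, and if $\mathrm{segment}(\pi(u))+1=\mathrm{segment}(\pi(v))$ then $\mathrm{color}(\pi(u))>\mathrm{color}(\pi(v))$.
   Context: $d_G$ is the shortest-path distance in $G$. For an injective $\pi:V\to\mathbb{Z}$ and distinct $u,v$, $\mathrm{dist}(u,v)=|\pi(u)-\pi(v)|/d_G(u,v)$; contraction and expansion are the minimum and maximum of these values over distinct pairs, and the distortion is expansion divided by contraction. A vertex $v$ pushes $u$ if $d_G(u,v)=|\pi(u)-\pi(v)|$. $\pi$ is a pushing embedding if, writing $V=\{v_1,\dots,v_n\}$ with $\pi(v_1)<\dots<\pi(v_n)$, $v_i$ pushes $v_{i+1}$ for all $1\le i<n$. For an integer position $i$, $\mathrm{segment}(i)=\lceil i/(d+1)\rceil$ and $\mathrm{color}(i)=((i-1)\bmod(d+1))+1$ (with the mod taking values in $\{0,\dots,d\}$). -}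

module Defs where

open import Data.Nat as ℕ using (ℕ; zero; suc)
open import Data.Integer as ℤ using (ℤ; +_; _-_; ∣_∣; _/ℕ_; _%ℕ_)
open import Data.Fin using (Fin)
open import Data.Product using (Σ; ∃; _×_; _,_)
open import Relation.Binary.PropositionalEquality using (_≡_; _≢_)
open import Relation.Nullary using (¬_)
open import Function.Definitions using (Injective)

record Graph (n : ℕ) : Set₁ where
  field
    Adj     : Fin n → Fin n → Set
    sym     : ∀ {u v} → Adj u v → Adj v u
    irrefl  : ∀ {u} → ¬ Adj u u

module _ {n : ℕ} (G : Graph n) where
  open Graph G

  data Walk : Fin n → Fin n → ℕ → Set where
    nil  : ∀ {u} → Walk u u 0
    cons : ∀ {u w v k} → Adj u w → Walk w v k → Walk u v (suc k)

  Connected : Set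
  Connected = ∀ u v → ∃ λ k → Walk u v k

  IsDist : Fin n → Fin n → ℕ → Set
  IsDist u v k = Walk u v k × (∀ m → Walk u v m → k ℕ.≤ m)

  Pushes : (Fin n → ℤ) → Fin n → Fin n → Set
  Pushes π v u = IsDist u v ∣ π u - π v ∣

  PushingEmbedding : (Fin n → ℤ) → Set
  PushingEmbedding π =
    Injective _≡_ _≡_ π ×
    (∀ u v → π u ℤ.< π v → (∀ w → ¬ (π u ℤ.< π w × π w ℤ.< π v)) → Pushes π u v)

  -- distortion(π) ≤ d, i.e. expansion ≤ d · contraction, i.e. for all pairs of
  -- distinct pairs (a,b), (c,e):
  --   |π a - π b| / d_G(a,b)  ≤  d · |π c - π e| / d_G(c,e)
  -- written with denominators cleared.
  DistortionAtMost : (Fin n → ℤ) → ℕ → Set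
  DistortionAtMost π d =
    ∀ a b c e → a ≢ b → c ≢ e → ∀ k l → IsDist a b k → IsDist c e l →
    ∣ π a - π b ∣ ℕ.* l ℕ.≤ d ℕ.* ∣ π c - π e ∣ ℕ.* k

-- segment(i) = ⌈ i / (d+1) ⌉ = ⌊ (i-1) / (d+1) ⌋ + 1
segment : ℕ → ℤ → ℤ
segment d i = ((i - + 1) /ℕ suc d) ℤ.+ + 1

color : ℕ → ℤ → ℕ
color d i = suc ((i - + 1) %ℕ suc d)

module _ {n : ℕ} (G : Graph n) where
  open Graph G

  EdgeCondition : (Fin n → ℤ) → ℕ → Set
  EdgeCondition π d =
    ∀ u v → Adj u v →
      (∣ segment d (π u) - segment d (π v) ∣ ℕ.≤ 1) ×
      (segment d (π u) ℤ.+ + 1 ≡ segment d (π v) → color d (π v) ℕ.< color d (π u))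

module Submission where

-- Proof idea.  Write D = d + 1 and gap(a,b) = |π a - π b|.
--
-- (1) Graph part (modules Walks, Pushing): for a pushing embedding, distortion ≤ d iff
--     every edge has gap ≤ d.  Consecutive vertices (in the order of π) push each other,
--     so chaining them joins any a, b by a walk of length ≤ gap(a,b): contraction is ≥ 1,
--     with equality at consecutive pairs; expansion is bounded edge by edge through the
--     triangle inequality.  Both use one induction principle along the order of π.
-- (2) Arithmetic part (module Blocks): |x - y| ≤ d iff the segment/color condition holds
--     in both directions.  With x - 1 = qD + r, 0 ≤ r < D (segment = q + 1, color = r + 1),
--     x - y = (r - s) + tD for the quotient difference t, and this has absolute value ≤ d
--     iff t = 0, or t = ±1 with the remainders ordered oppositely.

open import Defs
open import Data.Nat as ℕ using (ℕ; zero; suc; z≤n; s≤s; s≤s⁻¹; _≤_; _<_)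
import Data.Nat.Properties as ℕₚ
open import Data.Nat.Induction using (<-wellFounded)
import Data.Nat.Tactic.RingSolver as ℕSolver
open import Data.Integer as ℤ using (ℤ; +_; -[1+_]; _+_; _-_; _*_; -_; ∣_∣; _⊖_; _/ℕ_; _%ℕ_)
import Data.Integer.Properties as ℤₚ
open import Data.Integer.DivMod using (a≡a%ℕn+[a/ℕn]*n; n%ℕd<d)
open import Data.Integer.Tactic.RingSolver using (solve; solve-∀)
open import Data.Fin using (Fin)
import Data.Fin.Properties as Finₚ
open import Data.List using ([]; _∷_)
open import Data.Product using (∃; ∃₂; _×_; _,_; proj₁; proj₂)
open import Data.Empty using (⊥-elim)
open import Function.Bundles using (_⇔_; mk⇔; module Equivalence)
open import Function.Properties.Equivalence using (⇔-setoid)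
open import Induction.WellFounded using (Acc; acc)
open import Level using (0ℓ)
open import Relation.Binary.Definitions using (tri<; tri≈; tri>)
open import Relation.Binary.PropositionalEquality
  using (_≡_; _≢_; refl; sym; trans; cong; cong₂; subst; module ≡-Reasoning)
import Relation.Binary.Reasoning.Setoid as SetoidReasoning
open import Relation.Nullary using (¬_; Dec; yes; no)
open import Relation.Nullary.Decidable using (_×-dec_)

module ⇔-Reasoning = SetoidReasoning (⇔-setoid 0ℓ)

monus≤⇔≤plus : ∀ {a s d} → (a ℕ.∸ s ≤ d) ⇔ (a ≤ s ℕ.+ d)
monus≤⇔≤plus {a} {s} = mk⇔
  (λ a∸s≤d → ℕₚ.≤-trans (ℕₚ.m≤n+m∸n a s) (ℕₚ.+-monoʳ-≤ s a∸s≤d))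
  (ℕₚ.m≤n+o⇒m∸n≤o a s)

successor⇔difference : ∀ a b → (a + + 1 ≡ b) ⇔ (a - b ≡ -[1+ 0 ])
successor⇔difference a b = mk⇔
  (λ a+1≡b → begin
     a - b           ≡⟨ cong (λ c → a - c) (sym a+1≡b) ⟩
     a - (a + + 1)   ≡⟨ solve (a ∷ []) ⟩
     -[1+ 0 ]        ∎)
  (λ a-b≡-1 → begin
     a + + 1               ≡⟨ solve (a ∷ b ∷ []) ⟩
     (a - b) + + 1 + b     ≡⟨ cong (λ t → t + + 1 + b) a-b≡-1 ⟩
     -[1+ 0 ] + + 1 + b    ≡⟨ solve (b ∷ []) ⟩
     b                     ∎)
  where open ≡-Reasoning

module Blocks (d : ℕ) where

  D : ℕ
  D = suc d

  -- (r - s) + t·D : the difference of two integers whose remainders are r and s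
  -- and whose quotients differ by t.
  offset : ℤ → ℕ → ℕ → ℤ
  offset t r s = (+ r - + s) + t * + D

  offset-swap : ∀ t r s → offset (- t) r s ≡ - offset t s r
  offset-swap t r s = identity t (+ r) (+ s) (+ D)
    where
    identity : ∀ t r s D → (r - s) + (- t) * D ≡ - ((s - r) + t * D)
    identity = solve-∀

  ∣offset-pos∣ : ∀ m r s → s < D → ∣ offset (+ suc m) r s ∣ ≡ r ℕ.+ suc m ℕ.* D ℕ.∸ s
  ∣offset-pos∣ m r s s<D = begin
    ∣ (+ r - + s) + + suc m * + D ∣     ≡⟨ cong ∣_∣ (regroup (+ r) (+ s) (+ suc m) (+ D)) ⟩
    ∣ (+ r + + suc m * + D) - + s ∣     ≡⟨ cong (λ a → ∣ a - + s ∣) (sym embed) ⟩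
    ∣ + (r ℕ.+ suc m ℕ.* D) - + s ∣     ≡⟨ cong ∣_∣ (ℤₚ.m-n≡m⊖n _ s) ⟩
    ∣ (r ℕ.+ suc m ℕ.* D) ⊖ s ∣         ≡⟨ cong ∣_∣ (ℤₚ.⊖-≥ s≤) ⟩
    r ℕ.+ suc m ℕ.* D ℕ.∸ s             ∎
    where
    open ≡-Reasoning
    regroup : ∀ r s t D → (r - s) + t * D ≡ (r + t * D) - s
    regroup = solve-∀
    embed : + (r ℕ.+ suc m ℕ.* D) ≡ + r + + suc m * + D
    embed = trans (ℤₚ.pos-+ r _) (cong (_+_ (+ r)) (ℤₚ.pos-* (suc m) D))
    s≤ : s ≤ r ℕ.+ suc m ℕ.* D
    s≤ = ℕₚ.≤-trans (ℕₚ.<⇒≤ s<D) (ℕₚ.≤-trans (ℕₚ.m≤m+n D (m ℕ.* D)) (ℕₚ.m≤n+m _ r))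

  ∣offset-neg∣ : ∀ m r s → r < D → ∣ offset -[1+ m ] r s ∣ ≡ s ℕ.+ suc m ℕ.* D ℕ.∸ r
  ∣offset-neg∣ m r s r<D = begin
    ∣ offset (- + suc m) r s ∣   ≡⟨ cong ∣_∣ (offset-swap (+ suc m) r s) ⟩
    ∣ - offset (+ suc m) s r ∣   ≡⟨ ℤₚ.∣-i∣≡∣i∣ (offset (+ suc m) s r) ⟩
    ∣ offset (+ suc m) s r ∣     ≡⟨ ∣offset-pos∣ m s r r<D ⟩
    s ℕ.+ suc m ℕ.* D ℕ.∸ r      ∎
    where open ≡-Reasoning

  ∣offset-zero∣≤d : ∀ {r s} → r < D → s < D → ∣ offset (+ 0) r s ∣ ≤ d
  ∣offset-zero∣≤d {r} {s} r<D s<D = begin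
    ∣ offset (+ 0) r s ∣   ≡⟨ cong ∣_∣ (trans (drop-zero (+ r) (+ s) (+ D)) (ℤₚ.m-n≡m⊖n r s)) ⟩
    ∣ r ⊖ s ∣              ≤⟨ ℤₚ.∣m⊝n∣≤m⊔n r s ⟩
    r ℕ.⊔ s                ≤⟨ ℕₚ.⊔-lub (s≤s⁻¹ r<D) (s≤s⁻¹ s<D) ⟩
    d                      ∎
    where
    open ℕₚ.≤-Reasoning
    drop-zero : ∀ r s D → (r - s) + + 0 * D ≡ r - s
    drop-zero = solve-∀

  one-block : ∀ {r s} m → s < D → (r ℕ.+ suc m ℕ.* D ≤ s ℕ.+ d) ⇔ (m ≡ 0 × r < s)
  one-block {r} {s} zero s<D = mk⇔
    (λ le → refl , ℕₚ.+-cancelʳ-≤ d (suc r) s (subst (_≤ s ℕ.+ d) shift le))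
    (λ (_ , r<s) → subst (_≤ s ℕ.+ d) (sym shift) (ℕₚ.+-monoˡ-≤ d r<s))
    where
    shift : r ℕ.+ 1 ℕ.* D ≡ suc r ℕ.+ d
    shift = trans (cong (r ℕ.+_) (ℕₚ.*-identityˡ D)) (ℕₚ.+-suc r d)
  one-block {r} {s} (suc m) s<D = mk⇔
    (λ le → ⊥-elim (ℕₚ.<⇒≱ (ℕₚ.+-mono-< s<D (ℕₚ.n<1+n d)) (ℕₚ.≤-trans two-blocks le)))
    (λ { (() , _) })
    where
    two-blocks : D ℕ.+ D ≤ r ℕ.+ suc (suc m) ℕ.* D
    two-blocks = ℕₚ.≤-trans (ℕₚ.+-monoʳ-≤ D (ℕₚ.m≤m+n D (m ℕ.* D))) (ℕₚ.m≤n+m _ r)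

  -- Quotient difference t and remainders r, s describe integers in the same or in
  -- neighbouring blocks, the larger one having the smaller remainder.
  Adjacent : ℤ → ℕ → ℕ → Set
  Adjacent t r s = (∣ t ∣ ≤ 1) × (t ≡ + 1 → r < s) × (t ≡ -[1+ 0 ] → s < r)

  adjacent-zero : ∀ {r s} → Adjacent (+ 0) r s
  adjacent-zero = z≤n , (λ ()) , (λ ())

  adjacent-pos : ∀ m r s → Adjacent (+ suc m) r s ⇔ (m ≡ 0 × r < s)
  adjacent-pos m r s = mk⇔
    (λ { (s≤s z≤n , r<s , _) → refl , r<s refl })
    (λ { (refl , r<s) → s≤s z≤n , (λ _ → r<s) , (λ ()) })

  adjacent-neg : ∀ m r s → Adjacent -[1+ m ] r s ⇔ (m ≡ 0 × s < r)
  adjacent-neg m r s = mk⇔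
    (λ { (s≤s z≤n , _ , s<r) → refl , s<r refl })
    (λ { (refl , s<r) → s≤s z≤n , (λ ()) , (λ _ → s<r) })

  offset≤d⇔adjacent : ∀ t {r s} → r < D → s < D → (∣ offset t r s ∣ ≤ d) ⇔ Adjacent t r s
  offset≤d⇔adjacent (+ zero) r<D s<D =
    mk⇔ (λ _ → adjacent-zero) (λ _ → ∣offset-zero∣≤d r<D s<D)
  offset≤d⇔adjacent (+ suc m) {r} {s} r<D s<D = begin
    ∣ offset (+ suc m) r s ∣ ≤ d     ≡⟨ cong (_≤ d) (∣offset-pos∣ m r s s<D) ⟩
    r ℕ.+ suc m ℕ.* D ℕ.∸ s ≤ d      ≈⟨ monus≤⇔≤plus ⟩
    r ℕ.+ suc m ℕ.* D ≤ s ℕ.+ d      ≈⟨ one-block m s<D ⟩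
    (m ≡ 0 × r < s)                  ≈⟨ adjacent-pos m r s ⟨
    Adjacent (+ suc m) r s           ∎
    where open ⇔-Reasoning
  offset≤d⇔adjacent -[1+ m ] {r} {s} r<D s<D = begin
    ∣ offset -[1+ m ] r s ∣ ≤ d      ≡⟨ cong (_≤ d) (∣offset-neg∣ m r s r<D) ⟩
    s ℕ.+ suc m ℕ.* D ℕ.∸ r ≤ d      ≈⟨ monus≤⇔≤plus ⟩
    s ℕ.+ suc m ℕ.* D ≤ r ℕ.+ d      ≈⟨ one-block m r<D ⟩
    (m ≡ 0 × s < r)                  ≈⟨ adjacent-neg m r s ⟨
    Adjacent -[1+ m ] r s            ∎
    where open ⇔-Reasoning

  quotient : ℤ → ℤ
  quotient x = (x - + 1) /ℕ D

  remainder : ℤ → ℕ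
  remainder x = (x - + 1) %ℕ D

  remainder<D : ∀ x → remainder x < D
  remainder<D x = n%ℕd<d (x - + 1) D

  difference-as-offset : ∀ x y → x - y ≡ offset (quotient x - quotient y) (remainder x) (remainder y)
  difference-as-offset x y = begin
    x - y                                                      ≡⟨ shift x y ⟩
    (x - + 1) - (y - + 1)                                      ≡⟨ cong₂ _-_ (a≡a%ℕn+[a/ℕn]*n (x - + 1) D)
                                                                            (a≡a%ℕn+[a/ℕn]*n (y - + 1) D) ⟩
    (+ remainder x + quotient x * + D) - (+ remainder y + quotient y * + D)
                                                               ≡⟨ regroup (+ remainder x) (+ remainder y) (quotient x) (quotient y) (+ D) ⟩
    offset (quotient x - quotient y) (remainder x) (remainder y) ∎
    where
    open ≡-Reasoning
    shift : ∀ x y → x - y ≡ (x - + 1) - (y - + 1)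
    shift = solve-∀
    regroup : ∀ r s p q D → (r + p * D) - (s + q * D) ≡ (r - s) + (p - q) * D
    regroup = solve-∀

  SegmentCondition : ℤ → ℤ → Set
  SegmentCondition x y =
    (∣ segment d x - segment d y ∣ ≤ 1) × (segment d x + + 1 ≡ segment d y → color d y < color d x)

  segment-difference : ∀ x y → segment d x - segment d y ≡ quotient x - quotient y
  segment-difference x y = cancel (quotient x) (quotient y)
    where
    cancel : ∀ p q → (p + + 1) - (q + + 1) ≡ p - q
    cancel = solve-∀

  segment-before⇔ : ∀ x y → (segment d x + + 1 ≡ segment d y) ⇔ (quotient x - quotient y ≡ -[1+ 0 ])
  segment-before⇔ x y = begin
    segment d x + + 1 ≡ segment d y                  ≈⟨ successor⇔difference (segment d x) (segment d y) ⟩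
    segment d x - segment d y ≡ -[1+ 0 ]             ≡⟨ cong (_≡ -[1+ 0 ]) (segment-difference x y) ⟩
    quotient x - quotient y ≡ -[1+ 0 ]               ∎
    where open ⇔-Reasoning

  segment-after⇔ : ∀ x y → (segment d y + + 1 ≡ segment d x) ⇔ (quotient x - quotient y ≡ + 1)
  segment-after⇔ x y = begin
    segment d y + + 1 ≡ segment d x                  ≈⟨ segment-before⇔ y x ⟩
    quotient y - quotient x ≡ -[1+ 0 ]               ≡⟨ cong (_≡ -[1+ 0 ]) (flip (quotient x) (quotient y)) ⟩
    - (quotient x - quotient y) ≡ - + 1              ≈⟨ mk⇔ ℤₚ.neg-injective (cong (λ z → - z)) ⟩
    quotient x - quotient y ≡ + 1                    ∎
    where
    open ⇔-Reasoning
    flip : ∀ p q → q - p ≡ - (p - q)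
    flip = solve-∀

  segment-conditions⇔adjacent : ∀ x y →
    (SegmentCondition x y × SegmentCondition y x) ⇔ Adjacent (quotient x - quotient y) (remainder x) (remainder y)
  segment-conditions⇔adjacent x y = mk⇔
    (λ ((near , before) , (_ , after)) →
         subst (_≤ 1) same-gap near
       , (λ t≡1 → s≤s⁻¹ (after (Equivalence.from (segment-after⇔ x y) t≡1)))
       , (λ t≡-1 → s≤s⁻¹ (before (Equivalence.from (segment-before⇔ x y) t≡-1))))
    (λ (near , if-after , if-before) →
         (subst (_≤ 1) (sym same-gap) near , λ e → s≤s (if-before (Equivalence.to (segment-before⇔ x y) e)))
       , (subst (_≤ 1) (sym same-gap′) near , λ e → s≤s (if-after (Equivalence.to (segment-after⇔ x y) e))))
    where
    same-gap : ∣ segment d x - segment d y ∣ ≡ ∣ quotient x - quotient y ∣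
    same-gap = cong ∣_∣ (segment-difference x y)
    same-gap′ : ∣ segment d y - segment d x ∣ ≡ ∣ quotient x - quotient y ∣
    same-gap′ = trans (ℤₚ.∣i-j∣≡∣j-i∣ (segment d y) (segment d x)) same-gap

  distance≤d⇔segment-conditions : ∀ x y → (∣ x - y ∣ ≤ d) ⇔ (SegmentCondition x y × SegmentCondition y x)
  distance≤d⇔segment-conditions x y = begin
    ∣ x - y ∣ ≤ d                                      ≡⟨ cong (λ z → ∣ z ∣ ≤ d) (difference-as-offset x y) ⟩
    ∣ offset (quotient x - quotient y) (remainder x) (remainder y) ∣ ≤ d
                                                       ≈⟨ offset≤d⇔adjacent _ (remainder<D x) (remainder<D y) ⟩
    Adjacent (quotient x - quotient y) (remainder x) (remainder y)
                                                       ≈⟨ segment-conditions⇔adjacent x y ⟨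
    (SegmentCondition x y × SegmentCondition y x)      ∎
    where open ⇔-Reasoning

module Walks {n : ℕ} (G : Graph n) where
  open Graph G renaming (sym to Adj-sym)

  _++ᵂ_ : ∀ {u w v k m} → Walk G u w k → Walk G w v m → Walk G u v (k ℕ.+ m)
  nil ++ᵂ q = q
  cons a p ++ᵂ q = cons a (p ++ᵂ q)

  reverse : ∀ {u v k} → Walk G u v k → Walk G v u k
  reverse nil = nil
  reverse {k = suc k} (cons a p) =
    subst (Walk G _ _) (ℕₚ.+-comm k 1) (reverse p ++ᵂ cons (Adj-sym a) nil)

  adjacent⇒distinct : ∀ {u v} → Adj u v → u ≢ v
  adjacent⇒distinct adj refl = irrefl adj

  adjacent-distance : ∀ {u v} → Adj u v → IsDist G u v 1
  adjacent-distance {u} {v} adj = cons adj nil , positive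
    where
    positive : ∀ m → Walk G u v m → 1 ≤ m
    positive zero nil = ⊥-elim (irrefl adj)
    positive (suc m) _ = s≤s z≤n

module Pushing {n : ℕ} (G : Graph n) (π : Fin n → ℤ) (pushing : PushingEmbedding G π) where
  open Graph G using (Adj; irrefl)
  open Walks G

  private
    injective : ∀ {a b} → π a ≡ π b → a ≡ b
    injective = proj₁ pushing
    push : ∀ a b → π a ℤ.< π b → (∀ w → ¬ (π a ℤ.< π w × π w ℤ.< π b)) → Pushes G π a b
    push = proj₂ pushing

  gap : Fin n → Fin n → ℕ
  gap a b = ∣ π a - π b ∣

  gap-sym : ∀ a b → gap a b ≡ gap b a
  gap-sym a b = ℤₚ.∣i-j∣≡∣j-i∣ (π a) (π b)

  gap-positive : ∀ {a b} → a ≢ b → 0 < gap a b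
  gap-positive {a} {b} a≢b = ℕₚ.n≢0⇒n>0 λ gap≡0 →
    a≢b (injective (ℤₚ.i-j≡0⇒i≡j (π a) (π b) (ℤₚ.∣i∣≡0⇒i≡0 gap≡0)))

  ordered⇒distinct : ∀ {a b} → π a ℤ.< π b → a ≢ b
  ordered⇒distinct a<b refl = ℤₚ.<-irrefl refl a<b

  ordered-pair : ∀ {u v} → u ≢ v → ∃₂ λ a b → π a ℤ.< π b
  ordered-pair {u} {v} u≢v with ℤₚ.<-cmp (π u) (π v)
  ... | tri< u<v _ _ = u , v , u<v
  ... | tri> _ _ v<u = v , u , v<u
  ... | tri≈ _ πu≡πv _ = ⊥-elim (u≢v (injective πu≡πv))

  Between : Fin n → Fin n → Fin n → Set
  Between a b x = π a ℤ.< π x × π x ℤ.< π b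

  between? : ∀ a b → Dec (∃ (Between a b))
  between? a b = Finₚ.any? λ x → (π a ℤ.<? π x) ×-dec (π x ℤ.<? π b)

  gap-split : ∀ {a x b} → Between a b x → gap a b ≡ gap a x ℕ.+ gap x b
  gap-split {a} {x} {b} (a<x , x<b) = ℤₚ.+-injective (begin
    + gap a b                    ≡⟨ ℤₚ.∣-∣-≤ (ℤₚ.<⇒≤ (ℤₚ.<-trans a<x x<b)) ⟩
    π b - π a                    ≡⟨ through (π a) (π x) (π b) ⟩
    (π x - π a) + (π b - π x)    ≡⟨ cong₂ _+_ (ℤₚ.∣-∣-≤ (ℤₚ.<⇒≤ a<x)) (ℤₚ.∣-∣-≤ (ℤₚ.<⇒≤ x<b)) ⟨
    + gap a x + + gap x b        ≡⟨ ℤₚ.pos-+ (gap a x) (gap x b) ⟨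
    + (gap a x ℕ.+ gap x b)      ∎)
    where
    open ≡-Reasoning
    through : ∀ a x b → b - a ≡ (x - a) + (b - x)
    through = solve-∀

  order-induction : (P : Fin n → Fin n → Set) →
    (∀ {a b} → π a ℤ.< π b → (∀ w → ¬ Between a b w) → P a b) →
    (∀ {a x b} → Between a b x → P a x → P x b → P a b) →
    ∀ {a b} → π a ℤ.< π b → P a b
  order-induction P consecutive join a<b = go a<b (<-wellFounded _)
    where
    go : ∀ {a b} → π a ℤ.< π b → Acc _<_ (gap a b) → P a b
    go {a} {b} a<b (acc smaller) with between? a b
    ... | no none = consecutive a<b λ w between → none (w , between)
    ... | yes (x , between@(a<x , x<b)) =
      join between (go a<x (smaller left)) (go x<b (smaller right))
      where
      left : gap a x < gap a b
      left = subst (gap a x <_) (sym (gap-split between))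
                   (ℕₚ.m<m+n (gap a x) (gap-positive (ordered⇒distinct x<b)))
      right : gap x b < gap a b
      right = subst (gap x b <_) (sym (gap-split between))
                    (ℕₚ.m<n+m (gap x b) (gap-positive (ordered⇒distinct a<x)))

  consecutive-pair : ∀ {a b} → π a ℤ.< π b → ∃₂ λ c e → π c ℤ.< π e × (∀ w → ¬ Between c e w)
  consecutive-pair = order-induction _ (λ c<e none → _ , _ , c<e , none) (λ _ left _ → left)

  -- Consecutive vertices are joined by a walk as long as their gap (they push each
  -- other); concatenating these walks, every ordered pair has a walk no longer than its gap.
  ordered-walk : ∀ {a b} → π a ℤ.< π b → ∃ λ k → Walk G a b k × k ≤ gap a b
  ordered-walk = order-induction (λ a b → ∃ λ k → Walk G a b k × k ≤ gap a b) consecutive join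
    where
    consecutive : ∀ {a b} → π a ℤ.< π b → (∀ w → ¬ Between a b w) → ∃ λ k → Walk G a b k × k ≤ gap a b
    consecutive {a} {b} a<b none =
      gap a b , subst (Walk G a b) (gap-sym b a) (reverse (proj₁ (push a b a<b none))) , ℕₚ.≤-refl
    join : ∀ {a x b} → Between a b x → ∃ (λ k → Walk G a x k × k ≤ gap a x) →
           ∃ (λ m → Walk G x b m × m ≤ gap x b) → ∃ λ k → Walk G a b k × k ≤ gap a b
    join between (k , p , k≤) (m , q , m≤) =
      k ℕ.+ m , p ++ᵂ q , subst (k ℕ.+ m ≤_) (sym (gap-split between)) (ℕₚ.+-mono-≤ k≤ m≤)

  distance≤gap : ∀ {a b l} → IsDist G a b l → l ≤ gap a b
  distance≤gap {a} {b} (_ , shortest) with ℤₚ.<-cmp (π a) (π b)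
  ... | tri< a<b _ _ = let (k , p , k≤) = ordered-walk a<b in ℕₚ.≤-trans (shortest k p) k≤
  ... | tri> _ _ b<a = let (k , p , k≤) = ordered-walk b<a in
    ℕₚ.≤-trans (shortest k (reverse p)) (subst (k ≤_) (gap-sym b a) k≤)
  ... | tri≈ _ πa≡πb _ with injective πa≡πb
  ...   | refl = ℕₚ.≤-trans (shortest 0 nil) z≤n

  EdgeStretchAtMost : ℕ → Set
  EdgeStretchAtMost d = ∀ u v → Adj u v → gap u v ≤ d

  gap≤stretch*length : ∀ {d} → EdgeStretchAtMost d → ∀ {a b k} → Walk G a b k → gap a b ≤ d ℕ.* k
  gap≤stretch*length {d} stretch {a} nil =
    ℕₚ.≤-trans (ℕₚ.≤-reflexive (cong ∣_∣ (ℤₚ.i≡j⇒i-j≡0 {π a} refl))) z≤n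
  gap≤stretch*length {d} stretch {a} {b} {suc k} (cons {w = w} adj p) = begin
    ∣ π a - π b ∣                   ≡⟨ cong ∣_∣ (through (π a) (π w) (π b)) ⟩
    ∣ (π a - π w) + (π w - π b) ∣   ≤⟨ ℤₚ.∣i+j∣≤∣i∣+∣j∣ (π a - π w) (π w - π b) ⟩
    gap a w ℕ.+ gap w b            ≤⟨ ℕₚ.+-mono-≤ (stretch a w adj) (gap≤stretch*length stretch p) ⟩
    d ℕ.+ d ℕ.* k                  ≡⟨ ℕₚ.*-suc d k ⟨
    d ℕ.* suc k                    ∎
    where
    open ℕₚ.≤-Reasoning
    through : ∀ a w b → a - b ≡ (a - w) + (w - b)
    through = solve-∀

  -- For a pushing embedding, distortion ≤ d amounts to every edge being stretched by at most d:
  -- expansion is attained on edges and contraction (= 1) on consecutive pairs.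
  distortion⇔edge-stretch : ∀ d → DistortionAtMost G π d ⇔ EdgeStretchAtMost d
  distortion⇔edge-stretch d = mk⇔ edge-bound distortion-bound
    where
    -- Compare an edge with a consecutive pair c < e, whose distance equals its gap.
    edge-vs-consecutive : DistortionAtMost G π d → ∀ {u v c e} → Adj u v →
                          π c ℤ.< π e → (∀ w → ¬ Between c e w) → gap u v ≤ d
    edge-vs-consecutive distortion {u} {v} {c} {e} adj c<e none =
      ℕₚ.*-cancelʳ-≤ (gap u v) d (gap e c) {{ℕ.>-nonZero (gap-positive e≢c)}}
        (subst (gap u v ℕ.* gap e c ≤_) (ℕₚ.*-identityʳ _) bound)
      where
      e≢c : e ≢ c
      e≢c e≡c = ordered⇒distinct c<e (sym e≡c)
      bound : gap u v ℕ.* gap e c ≤ d ℕ.* gap e c ℕ.* 1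
      bound = distortion u v e c (adjacent⇒distinct adj) e≢c 1 (gap e c)
                (adjacent-distance adj) (push c e c<e none)
    edge-bound : DistortionAtMost G π d → EdgeStretchAtMost d
    edge-bound distortion u v adj =
      let (_ , _ , a<b) = ordered-pair (adjacent⇒distinct adj)
          (_ , _ , c<e , none) = consecutive-pair a<b
      in edge-vs-consecutive distortion adj c<e none
    -- Expansion ≤ d via the triangle inequality along a shortest walk, contraction ≥ 1.
    distortion-bound : EdgeStretchAtMost d → DistortionAtMost G π d
    distortion-bound stretch a b c e _ _ k l (walk , _) distance = begin
      gap a b ℕ.* l              ≤⟨ ℕₚ.*-mono-≤ (gap≤stretch*length stretch walk) (distance≤gap distance) ⟩
      d ℕ.* k ℕ.* gap c e        ≡⟨ reorder d k (gap c e) ⟩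
      d ℕ.* gap c e ℕ.* k        ∎
      where
      open ℕₚ.≤-Reasoning
      reorder : ∀ d k g → d ℕ.* k ℕ.* g ≡ d ℕ.* g ℕ.* k
      reorder = ℕSolver.solve-∀

-- Per edge, stretch ≤ d is the segment condition read in both directions; since edges are
-- symmetric, demanding one direction for every (ordered) edge demands both.
edge-stretch⇔edge-condition : ∀ {n} (G : Graph n) (π : Fin n → ℤ) d →
  (∀ u v → Graph.Adj G u v → ∣ π u - π v ∣ ≤ d) ⇔ EdgeCondition G π d
edge-stretch⇔edge-condition G π d = mk⇔
  (λ stretch u v adj → proj₁ (to (distance≤d⇔segment-conditions (π u) (π v)) (stretch u v adj)))
  (λ condition u v adj → from (distance≤d⇔segment-conditions (π u) (π v))
                               (condition u v adj , condition v u (Graph.sym G adj)))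
  where
  open Blocks d using (distance≤d⇔segment-conditions)
  open Equivalence

lemma7 : (n : ℕ) (G : Graph n) → Connected G → (d : ℕ) → 1 ≤ d →
    (π : Fin n → ℤ) → PushingEmbedding G π →
    DistortionAtMost G π d ⇔ EdgeCondition G π d
lemma7 n G _ d _ π pushing = begin
  DistortionAtMost G π d   ≈⟨ distortion⇔edge-stretch d ⟩
  EdgeStretchAtMost d      ≈⟨ edge-stretch⇔edge-condition G π d ⟩
  EdgeCondition G π d      ∎
  where
  open Pushing G π pushing using (EdgeStretchAtMost; distortion⇔edge-stretch)
  open ⇔-Reasoning
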